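{- Let $\varphi = C_1 \wedge \cdots \wedge C_m$ be an E3-SAT instance over Boolean variables $x_1,\dots,x_n$, where each clause $C_i = C_{i,1}\vee C_{i,2}\vee C_{i,3}$ is a disjunction of exactly three literals, each literal being some $x_k$ or $\neg x_k$ with $k\in[1..n]$. Construct the following MWTM instance. The tree $T$ has nodes $1,\dots,1+2n+3m$ and is rooted at node $1$. For each $k\in[1..n]$, nodes $2k$ (representing $x_k$) and $2k+1$ (representing $\neg x_k$) are children of the root. For each $i\in[1..m]$ and $j\in[1..3]$, node $1+2n+3(i-1)+j$ is a child of node $2k$ if $C_{i,j}=x_k$, and a child of node $2k+1$ if $C_{i,j}=\neg x_k$. There are $m+n$ tasks $1,\dots,m+n$, and the weight of assigning node $i$ to task $j$ is $$w_{i,j}=\begin{cases}0, & i=1,\ j\in[1..m+n],\\ 1, & i\in[2..2n+1],\ j=m+\lfloor i/2\rfloor,\\ 1, & i\in[2n+2..2n+3m+1],\ j=\lfloor (i-2n-2)/3\rfloor+1,\\ 0, & \text{otherwise.}\end{cases}$$ Then $\varphi$ is satisfiable if and only if this MWTM instance has a feasible assignment of total weight $n+m$.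
   Context: An MWTM (Maximum Weight Tree Matching) instance consists of a rooted tree $T$ with node set $\{1,\dots,N\}$, a set of $M$ tasks $\{1,\dots,M\}$, and real weights $w_{i,j}$ for every node $i$ and task $j$. A feasible assignment assigns every task to a node such that distinct tasks go to distinct nodes (a matching), and no assigned node is an ancestor (equivalently, descendant) of another assigned node. Its total weight is the sum of $w_{i,j}$ over assigned pairs $(i,j)$. The MWTM problem asks for a feasible assignment of maximum total weight. -}

module Defs where

open import Data.Nat using (ℕ; zero; suc; _+_; _*_; _∸_; _/_; _≡ᵇ_; _≤ᵇ_)
open import Data.Bool using (Bool; true; false; not; if_then_else_; _∧_)
open import Data.Fin using (Fin; toℕ)
open import Data.Product using (_×_; _,_; Σ; ∃)
open import Data.List using (List; tabulate)
open import Data.Nat.ListAction using (sum)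
open import Relation.Binary.PropositionalEquality using (_≡_)
open import Relation.Nullary using (¬_)
open import Function.Definitions using (Injective)

-- A literal over variables x_1..x_n: (k , b) with k : Fin n (0-based index,
-- i.e. variable x_{toℕ k + 1}); b = true means x_k, b = false means ¬ x_k.
Lit : ℕ → Set
Lit n = Fin n × Bool

-- An E3-SAT instance with n variables and m clauses:
-- φ i j is the literal C_{i+1, j+1}.
E3SAT : ℕ → ℕ → Set
E3SAT n m = Fin m → Fin 3 → Lit n

litVal : ∀ {n} → (Fin n → Bool) → Lit n → Bool
litVal σ (k , true)  = σ k
litVal σ (k , false) = not (σ k)

Satisfiable : ∀ {n m} → E3SAT n m → Set
Satisfiable {n} {m} φ =
  Σ (Fin n → Bool) λ σ → (i : Fin m) → ∃ λ (j : Fin 3) → litVal σ (φ i j) ≡ true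

record MWTM : Set₁ where
  field
    N      : ℕ                      -- nodes are Fin N (node label = toℕ + 1)
    M      : ℕ                      -- tasks are Fin M (task label = toℕ + 1)
    Parent : Fin N → Fin N → Set    -- Parent u v : u is the parent of v in T
    weight : Fin N → Fin M → ℕ

module _ (I : MWTM) where
  open MWTM I

  data Ancestor : Fin N → Fin N → Set where
    par  : ∀ {u v} → Parent u v → Ancestor u v
    step : ∀ {u w v} → Ancestor u w → Parent w v → Ancestor u v

  Feasible : (Fin M → Fin N) → Set
  Feasible a = Injective _≡_ _≡_ a × ((t t' : Fin M) → ¬ Ancestor (a t) (a t'))

  totalWeight : (Fin M → Fin N) → ℕ
  totalWeight a = sum (tabulate λ t → weight (a t) t)

-- The reduction (labels 1-based as in the paper)

-- ParentL φ p c : node with label p is the parent of node with label c.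
data ParentL {n m : ℕ} (φ : E3SAT n m) : ℕ → ℕ → Set where
  root-pos : (k : Fin n) → ParentL φ 1 (2 * suc (toℕ k))
  root-neg : (k : Fin n) → ParentL φ 1 (2 * suc (toℕ k) + 1)
  clause-pos : (i : Fin m) (j : Fin 3) (k : Fin n) → φ i j ≡ (k , true) →
    ParentL φ (2 * suc (toℕ k)) (1 + 2 * n + 3 * toℕ i + suc (toℕ j))
  clause-neg : (i : Fin m) (j : Fin 3) (k : Fin n) → φ i j ≡ (k , false) →
    ParentL φ (2 * suc (toℕ k) + 1) (1 + 2 * n + 3 * toℕ i + suc (toℕ j))

wL : ℕ → ℕ → ℕ → ℕ → ℕ
wL n m i j =
  if i ≡ᵇ 1 then 0
  else if (2 ≤ᵇ i) ∧ (i ≤ᵇ 2 * n + 1) ∧ (j ≡ᵇ m + i / 2) then 1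
  else if (2 * n + 2 ≤ᵇ i) ∧ (i ≤ᵇ 2 * n + 3 * m + 1)
          ∧ (j ≡ᵇ (i ∸ (2 * n + 2)) / 3 + 1) then 1
  else 0

reduction : ∀ {n m} → E3SAT n m → MWTM
reduction {n} {m} φ = record
  { N      = 1 + 2 * n + 3 * m
  ; M      = m + n
  ; Parent = λ u v → ParentL φ (suc (toℕ u)) (suc (toℕ v))
  ; weight = λ v t → wL n m (suc (toℕ v)) (suc (toℕ t))
  }

-- A literal node may be assigned to its variable's task, and a clause-occurrence node to its clause's
-- task; these are the only weight-1 pairs, so a weight-(n + m) assignment gives every variable task a
-- literal node of that variable and every clause task an occurrence node of that clause.  Since T has
-- depth two, the antichain condition says exactly that no chosen occurrence node is a child of a
-- chosen literal node.  Reading the chosen literal of each variable as the false one, this says that every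
-- clause has a true literal.

module Submission where

open import Defs
open import Data.Bool using (Bool; true; false; not; if_then_else_; T)
open import Data.Bool.Properties using (not-involutive; ¬-not)
open import Data.Fin using (Fin; zero; suc; toℕ; fromℕ<; combine; cast; splitAt; join; _↑ˡ_; _↑ʳ_)
open import Data.Fin.Properties
  using ( toℕ-injective; toℕ<n; toℕ-fromℕ<; toℕ-cast; toℕ-combine; combine-injective
        ; combine-surjective; toℕ-↑ˡ; toℕ-↑ʳ; splitAt⁻¹-↑ˡ; splitAt⁻¹-↑ʳ; join-splitAt )
  renaming (suc-injective to fin-suc-injective)
open import Data.List using (tabulate)
open import Data.Nat
  using (ℕ; zero; suc; pred; _+_; _*_; _∸_; _/_; _≤_; _<_; _≡ᵇ_; _≟_; _≤?_; z≤n; s≤s)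
open import Data.Nat.DivMod using (+-distrib-/-∣ˡ; m*n/n≡m; m<n⇒m/n≡0)
open import Data.Nat.Divisibility using (m∣m*n)
open import Data.Nat.ListAction using (sum)
open import Data.Nat.Properties
open import Data.Nat.Tactic.RingSolver using (solve-∀)
open import Data.Product using (Σ; ∃; ∃₂; _×_; _,_; proj₁; proj₂)
open import Data.Sum using (_⊎_; inj₁; inj₂)
open import Data.Unit using (tt)
open import Function using (_∘_)
open import Function.Bundles using (_⇔_; mk⇔)
open import Relation.Binary.PropositionalEquality
open import Relation.Nullary using (¬_; contradiction)
open import Relation.Nullary.Decidable using (dec-true; dec-false)

toℕ-combine-/ : ∀ {m d} (i : Fin m) (j : Fin (suc d)) → toℕ (combine i j) / suc d ≡ toℕ i
toℕ-combine-/ {d = d} i j = begin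
  toℕ (combine i j) / suc d             ≡⟨ cong (_/ suc d) (toℕ-combine i j) ⟩
  (suc d * toℕ i + toℕ j) / suc d       ≡⟨ +-distrib-/-∣ˡ (toℕ j) (m∣m*n (toℕ i)) ⟩
  suc d * toℕ i / suc d + toℕ j / suc d ≡⟨ cong₂ _+_ (cong (_/ suc d) (*-comm (suc d) (toℕ i)))
                                                      (m<n⇒m/n≡0 (toℕ<n j)) ⟩
  toℕ i * suc d / suc d + 0             ≡⟨ cong (_+ 0) (m*n/n≡m (toℕ i) (suc d)) ⟩
  toℕ i + 0                             ≡⟨ +-identityʳ (toℕ i) ⟩
  toℕ i                                 ∎
  where open ≡-Reasoning

toℕ-combine-surjective : ∀ {m d} (x : Fin (d * m)) →
                         ∃₂ λ (i : Fin m) (j : Fin d) → toℕ (combine i j) ≡ toℕ x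
toℕ-combine-surjective {m} {d} x with i , j , e ← combine-surjective (cast (*-comm d m) x) =
  i , j , trans (cong toℕ e) (toℕ-cast (*-comm d m) x)

sum-tabulate-≡1 : ∀ {N} (f : Fin N → ℕ) → (∀ i → f i ≡ 1) → sum (tabulate f) ≡ N
sum-tabulate-≡1 {zero}  f f≡1 = refl
sum-tabulate-≡1 {suc N} f f≡1 = cong₂ _+_ (f≡1 zero) (sum-tabulate-≡1 (f ∘ suc) (f≡1 ∘ suc))

sum-tabulate-≤1 : ∀ {N} (f : Fin N → ℕ) → (∀ i → f i ≤ 1) → sum (tabulate f) ≤ N
sum-tabulate-≤1 {zero}  f f≤1 = z≤n
sum-tabulate-≤1 {suc N} f f≤1 = +-mono-≤ (f≤1 zero) (sum-tabulate-≤1 (f ∘ suc) (f≤1 ∘ suc))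

sum-tabulate-≤1-≡ : ∀ {N} (f : Fin N → ℕ) → (∀ i → f i ≤ 1) → sum (tabulate f) ≡ N →
                    ∀ i → f i ≡ 1
sum-tabulate-≤1-≡ {suc N} f f≤1 sum≡ = λ where
    zero    → head≡1
    (suc i) → sum-tabulate-≤1-≡ (f ∘ suc) (f≤1 ∘ suc) tail≡N i
  where
  tail = sum (tabulate (f ∘ suc))

  head≡1 : f zero ≡ 1
  head≡1 = ≤-antisym (f≤1 zero) (+-cancelʳ-≤ N 1 (f zero) (begin
    suc N         ≡⟨ sum≡ ⟨
    f zero + tail ≤⟨ +-monoʳ-≤ (f zero) (sum-tabulate-≤1 (f ∘ suc) (f≤1 ∘ suc)) ⟩
    f zero + N    ∎))
    where open ≤-Reasoning

  tail≡N : tail ≡ N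
  tail≡N = suc-injective (trans (cong (_+ tail) (sym head≡1)) sum≡)

indicator≤1 : ∀ b → (if b then 1 else 0) ≤ 1
indicator≤1 true  = ≤-refl
indicator≤1 false = z≤n

indicator≡1⇒T : ∀ {b} → (if b then 1 else 0) ≡ 1 → T b
indicator≡1⇒T {true} _ = tt

wL-literal : ∀ n m {l} t → 2 ≤ l → l ≤ 2 * n + 1 → wL n m l t ≡ (if t ≡ᵇ m + l / 2 then 1 else 0)
wL-literal n m {l@(suc (suc _))} t (s≤s (s≤s _)) l≤
  rewrite dec-true (l ≤? 2 * n + 1) l≤
  with t ≡ᵇ m + l / 2
... | true  = refl
... | false rewrite dec-false (2 * n + 2 ≤? l) (<⇒≱ (≤-<-trans l≤ (+-monoʳ-< (2 * n) ≤-refl))) = refl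

wL-clause : ∀ n m {l} t → 2 * n + 2 ≤ l → l ≤ 2 * n + 3 * m + 1 →
            wL n m l t ≡ (if t ≡ᵇ (l ∸ (2 * n + 2)) / 3 + 1 then 1 else 0)
wL-clause n m {l} t ≤l l≤
  rewrite dec-false (l ≟ 1) (<⇒≢ (≤-trans (m≤n+m 2 (2 * n)) ≤l) ∘ sym)
        | dec-true (2 ≤? l) (≤-trans (m≤n+m 2 (2 * n)) ≤l)
        | dec-false (l ≤? 2 * n + 1) (<⇒≱ (≤-trans (≤-reflexive (sym (+-suc (2 * n) 1))) ≤l))
        | dec-true (2 * n + 2 ≤? l) ≤l
        | dec-true (l ≤? 2 * n + 3 * m + 1) l≤
  = refl

data Node (n m : ℕ) : Set where
  root   : Node n m
  lit    : Fin n → Bool → Node n m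
  clause : Fin m → Fin 3 → Node n m

bit : Bool → Fin 2
bit true  = zero
bit false = suc zero

bit-injective : ∀ {b b′} → bit b ≡ bit b′ → b ≡ b′
bit-injective {true}  {true}  _ = refl
bit-injective {false} {false} _ = refl

module Encoding (n m : ℕ) where

  -- The paper's 1-based node numbers, written exactly as in ParentL so that Edge and ParentL
  -- correspond constructor by constructor.
  label : Node n m → ℕ
  label root          = 1
  label (lit k true)  = 2 * suc (toℕ k)
  label (lit k false) = 2 * suc (toℕ k) + 1
  label (clause i j)  = 1 + 2 * n + 3 * toℕ i + suc (toℕ j)

  -- The 1-based task on which a node has weight 1; the root has none, and 0 is no task label.
  task : Node n m → ℕ
  task root         = 0
  task (lit k _)    = m + suc (toℕ k)
  task (clause i _) = suc (toℕ i)

  label-lit : ∀ k b → label (lit k b) ≡ toℕ (combine (suc k) (bit b))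
  label-lit k true  = sym (trans (toℕ-combine (suc k) zero) (+-identityʳ _))
  label-lit k false = sym (toℕ-combine (suc k) (suc zero))

  label-clause : ∀ i j → label (clause i j) ≡ 2 * n + 2 + toℕ (combine i j)
  label-clause i j = trans (normalise n (toℕ i) (toℕ j)) (cong (2 * n + 2 +_) (sym (toℕ-combine i j)))
    where
    normalise : ∀ n i j → 1 + 2 * n + 3 * i + suc j ≡ 2 * n + 2 + (3 * i + j)
    normalise = solve-∀

  label-lit≥2 : ∀ k b → 2 ≤ label (lit k b)
  label-lit≥2 k b rewrite label-lit k b = s≤s (s≤s z≤n)

  label-lit≤2n+1 : ∀ k b → label (lit k b) ≤ 2 * n + 1
  label-lit≤2n+1 k b = ≤-pred (begin
    suc (label (lit k b))  ≡⟨ cong suc (label-lit k b) ⟩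
    suc (toℕ c)            ≤⟨ toℕ<n c ⟩
    suc n * 2              ≡⟨ normalise n ⟩
    suc (2 * n + 1)        ∎)
    where
    open ≤-Reasoning
    c = combine (suc k) (bit b)
    normalise : ∀ n → suc n * 2 ≡ suc (2 * n + 1)
    normalise = solve-∀

  label-clause≥2n+2 : ∀ i j → 2 * n + 2 ≤ label (clause i j)
  label-clause≥2n+2 i j rewrite label-clause i j = m≤m+n (2 * n + 2) _

  label-clause≤2n+3m+1 : ∀ i j → label (clause i j) ≤ 2 * n + 3 * m + 1
  label-clause≤2n+3m+1 i j = begin
    label (clause i j)            ≡⟨ label-clause i j ⟩
    2 * n + 2 + toℕ c             ≡⟨ normalise n (toℕ c) ⟩
    2 * n + 1 + suc (toℕ c)       ≤⟨ +-monoʳ-≤ (2 * n + 1) (toℕ<n c) ⟩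
    2 * n + 1 + m * 3             ≡⟨ normalise′ n m ⟩
    2 * n + 3 * m + 1             ∎
    where
    open ≤-Reasoning
    c = combine i j
    normalise : ∀ n c → 2 * n + 2 + c ≡ 2 * n + 1 + suc c
    normalise = solve-∀
    normalise′ : ∀ n m → 2 * n + 1 + m * 3 ≡ 2 * n + 3 * m + 1
    normalise′ = solve-∀

  label-lit<clause : ∀ k b i j → label (lit k b) < label (clause i j)
  label-lit<clause k b i j = begin-strict
    label (lit k b)     ≤⟨ label-lit≤2n+1 k b ⟩
    2 * n + 1           <⟨ +-monoʳ-< (2 * n) ≤-refl ⟩
    2 * n + 2           ≤⟨ label-clause≥2n+2 i j ⟩
    label (clause i j)  ∎
    where open ≤-Reasoning

  label-clause≥2 : ∀ i j → 2 ≤ label (clause i j)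
  label-clause≥2 i j = ≤-trans (m≤n+m 2 (2 * n)) (label-clause≥2n+2 i j)

  label-injective : ∀ {u v} → label u ≡ label v → u ≡ v
  label-injective {root}       {root}         _ = refl
  label-injective {root}       {lit k b}      e = contradiction e (<⇒≢ (label-lit≥2 k b))
  label-injective {root}       {clause i j}   e = contradiction e (<⇒≢ (label-clause≥2 i j))
  label-injective {lit k b}    {root}         e = contradiction e (>⇒≢ (label-lit≥2 k b))
  label-injective {lit k b}    {lit k′ b′}    e
    with k≡k′ , b≡b′ ← combine-injective (suc k) (bit b) (suc k′) (bit b′)
                         (toℕ-injective (trans (sym (label-lit k b)) (trans e (label-lit k′ b′))))
    = cong₂ lit (fin-suc-injective k≡k′) (bit-injective b≡b′)
  label-injective {lit k b}    {clause i j}   e = contradiction e (<⇒≢ (label-lit<clause k b i j))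
  label-injective {clause i j} {root}         e = contradiction e (>⇒≢ (label-clause≥2 i j))
  label-injective {clause i j} {lit k b}      e = contradiction e (>⇒≢ (label-lit<clause k b i j))
  label-injective {clause i j} {clause i′ j′} e
    with i≡i′ , j≡j′ ← combine-injective i j i′ j′
                         (toℕ-injective (+-cancelˡ-≡ (2 * n + 2) _ _
                           (trans (sym (label-clause i j)) (trans e (label-clause i′ j′)))))
    = cong₂ clause i≡i′ j≡j′

  label-lit-onto : (c : Fin (2 * n)) → ∃ λ v → label v ≡ 2 + toℕ c
  label-lit-onto c with toℕ-combine-surjective c
  ... | k , zero     , e = lit k true  , trans (label-lit k true)  (cong (2 +_) e)
  ... | k , suc zero , e = lit k false , trans (label-lit k false) (cong (2 +_) e)

  label-clause-onto : (c : Fin (3 * m)) → ∃ λ v → label v ≡ 2 * n + 2 + toℕ c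
  label-clause-onto c with i , j , e ← toℕ-combine-surjective c =
    clause i j , trans (label-clause i j) (cong (2 * n + 2 +_) e)

  classify : (x : Fin (1 + 2 * n + 3 * m)) → ∃ λ v → label v ≡ suc (toℕ x)
  classify zero = root , refl
  classify (suc y) with splitAt (2 * n) y in eq
  ... | inj₁ c with v , e ← label-lit-onto c =
    v , trans e (cong (2 +_) (trans (sym (toℕ-↑ˡ c (3 * m))) (cong toℕ (splitAt⁻¹-↑ˡ eq))))
  ... | inj₂ c with v , e ← label-clause-onto c =
    v , trans e (trans (normalise (2 * n) (toℕ c))
                   (cong (2 +_) (trans (sym (toℕ-↑ʳ (2 * n) c)) (cong toℕ (splitAt⁻¹-↑ʳ eq)))))
    where
    normalise : ∀ a c → a + 2 + c ≡ 2 + (a + c)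
    normalise = solve-∀

  nodeOf : Fin (1 + 2 * n + 3 * m) → Node n m
  nodeOf x = proj₁ (classify x)

  label-nodeOf : ∀ x → label (nodeOf x) ≡ suc (toℕ x)
  label-nodeOf x = proj₂ (classify x)

  label≤1+2n+3m : ∀ v → label v ≤ 1 + 2 * n + 3 * m
  label≤1+2n+3m root         = s≤s z≤n
  label≤1+2n+3m (lit k b)    = begin
    label (lit k b)      ≤⟨ label-lit≤2n+1 k b ⟩
    2 * n + 1            ≡⟨ +-comm (2 * n) 1 ⟩
    1 + 2 * n            ≤⟨ m≤m+n (1 + 2 * n) (3 * m) ⟩
    1 + 2 * n + 3 * m    ∎
    where open ≤-Reasoning
  label≤1+2n+3m (clause i j) = ≤-trans (label-clause≤2n+3m+1 i j) (≤-reflexive (+-comm (2 * n + 3 * m) 1))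

  suc-pred-label : ∀ v → suc (pred (label v)) ≡ label v
  suc-pred-label root          = refl
  suc-pred-label (lit k true)  = refl
  suc-pred-label (lit k false) = refl
  suc-pred-label (clause i j)  = refl

  toFin : Node n m → Fin (1 + 2 * n + 3 * m)
  toFin v = fromℕ< (subst (_≤ 1 + 2 * n + 3 * m) (sym (suc-pred-label v)) (label≤1+2n+3m v))

  label-toFin : ∀ v → suc (toℕ (toFin v)) ≡ label v
  label-toFin v = trans (cong suc (toℕ-fromℕ< _)) (suc-pred-label v)

  nodeOf-toFin : ∀ v → nodeOf (toFin v) ≡ v
  nodeOf-toFin v = label-injective (trans (label-nodeOf (toFin v)) (label-toFin v))

  wL-label : ∀ v t → wL n m (label v) (suc t) ≡ (if suc t ≡ᵇ task v then 1 else 0)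
  wL-label root         t = refl
  wL-label (lit k b)    t = trans (wL-literal n m (suc t) (label-lit≥2 k b) (label-lit≤2n+1 k b))
    (cong (λ q → if suc t ≡ᵇ m + q then 1 else 0)
          (trans (cong (_/ 2) (label-lit k b)) (toℕ-combine-/ (suc k) (bit b))))
  wL-label (clause i j) t = trans (wL-clause n m (suc t) (label-clause≥2n+2 i j) (label-clause≤2n+3m+1 i j))
    (cong (λ q → if suc t ≡ᵇ q then 1 else 0) clause-task)
    where
    clause-task : (label (clause i j) ∸ (2 * n + 2)) / 3 + 1 ≡ suc (toℕ i)
    clause-task = begin
      (label (clause i j) ∸ (2 * n + 2)) / 3 + 1 ≡⟨ cong (λ l → (l ∸ (2 * n + 2)) / 3 + 1) (label-clause i j) ⟩
      (2 * n + 2 + toℕ c ∸ (2 * n + 2)) / 3 + 1  ≡⟨ cong (λ l → l / 3 + 1) (m+n∸m≡n (2 * n + 2) (toℕ c)) ⟩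
      toℕ c / 3 + 1                              ≡⟨ cong (_+ 1) (toℕ-combine-/ i j) ⟩
      toℕ i + 1                                  ≡⟨ +-comm (toℕ i) 1 ⟩
      suc (toℕ i)                                ∎
      where
      open ≡-Reasoning
      c = combine i j

  wL-label≤1 : ∀ v t → wL n m (label v) (suc t) ≤ 1
  wL-label≤1 v t = subst (_≤ 1) (sym (wL-label v t)) (indicator≤1 (suc t ≡ᵇ task v))

  wL-label≡1⇒ : ∀ v t → wL n m (label v) (suc t) ≡ 1 → suc t ≡ task v
  wL-label≡1⇒ v t w≡1 = ≡ᵇ⇒≡ (suc t) (task v) (indicator≡1⇒T (trans (sym (wL-label v t)) w≡1))

  wL-label-task : ∀ v t → suc t ≡ task v → wL n m (label v) (suc t) ≡ 1
  wL-label-task v t t≡ rewrite wL-label v t | dec-true (suc t ≟ task v) t≡ = refl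

  task≡lit⇒ : ∀ v k → task v ≡ m + suc (toℕ k) → ∃ λ b → v ≡ lit k b
  task≡lit⇒ root         k e = contradiction (sym e) (m+1+n≢0 m)
  task≡lit⇒ (lit k′ b)   k e =
    b , cong (λ k → lit k b) (toℕ-injective (suc-injective (+-cancelˡ-≡ m _ _ e)))
  task≡lit⇒ (clause i j) k e = contradiction e (<⇒≢ (≤-<-trans (toℕ<n i) (m<m+n m (s≤s z≤n))))

  task≡clause⇒ : ∀ v i → task v ≡ suc (toℕ i) → ∃ λ j → v ≡ clause i j
  task≡clause⇒ root          i ()
  task≡clause⇒ (lit k b)     i e = contradiction e (>⇒≢ (≤-<-trans (toℕ<n i) (m<m+n m (s≤s z≤n))))
  task≡clause⇒ (clause i′ j) i e = j , cong (λ i → clause i j) (toℕ-injective (suc-injective e))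

litVal-not : ∀ {n} (σ : Fin n → Bool) k → litVal σ (k , not (σ k)) ≡ false
litVal-not σ k with σ k in σk
... | true  = cong not σk
... | false = σk

litVal≡false⇒ : ∀ {n} (σ : Fin n → Bool) k b → litVal σ (k , b) ≡ false → b ≡ not (σ k)
litVal≡false⇒ σ k true  σk≡false = sym (cong not σk≡false)
litVal≡false⇒ σ k false ¬σk≡false = sym ¬σk≡false

module _ {n m : ℕ} (φ : E3SAT n m) where

  open Encoding n m

  private
    I = reduction φ
    Nodes = Fin (1 + 2 * n + 3 * m)
    Tasks = Fin (m + n)

  data Edge : Node n m → Node n m → Set where
    root-lit   : ∀ k b → Edge root (lit k b)
    lit-clause : ∀ {i j k b} → φ i j ≡ (k , b) → Edge (lit k b) (clause i j)

  edge⇒ParentL : ∀ {u v} → Edge u v → ParentL φ (label u) (label v)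
  edge⇒ParentL (root-lit k true)                  = root-pos k
  edge⇒ParentL (root-lit k false)                 = root-neg k
  edge⇒ParentL (lit-clause {i} {j} {k} {true}  e) = clause-pos i j k e
  edge⇒ParentL (lit-clause {i} {j} {k} {false} e) = clause-neg i j k e

  ParentL⇒edge : ∀ {p c u v} → ParentL φ p c → label u ≡ p → label v ≡ c → Edge u v
  ParentL⇒edge {u = u} {v = v} (root-pos k) eu ev
    with refl ← label-injective {u} {root} eu | refl ← label-injective {v} {lit k true} ev
    = root-lit k true
  ParentL⇒edge {u = u} {v = v} (root-neg k) eu ev
    with refl ← label-injective {u} {root} eu | refl ← label-injective {v} {lit k false} ev
    = root-lit k false
  ParentL⇒edge {u = u} {v = v} (clause-pos i j k e) eu ev
    with refl ← label-injective {u} {lit k true} eu | refl ← label-injective {v} {clause i j} ev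
    = lit-clause e
  ParentL⇒edge {u = u} {v = v} (clause-neg i j k e) eu ev
    with refl ← label-injective {u} {lit k false} eu | refl ← label-injective {v} {clause i j} ev
    = lit-clause e

  parent⇒edge : ∀ {x y} → MWTM.Parent I x y → Edge (nodeOf x) (nodeOf y)
  parent⇒edge {x} {y} p = ParentL⇒edge p (label-nodeOf x) (label-nodeOf y)

  edge⇒parent : ∀ {x y} → Edge (nodeOf x) (nodeOf y) → MWTM.Parent I x y
  edge⇒parent {x} {y} e = subst₂ (ParentL φ) (label-nodeOf x) (label-nodeOf y) (edge⇒ParentL e)

  edge-edge⇒root : ∀ {u w v} → Edge u w → Edge w v → u ≡ root
  edge-edge⇒root (root-lit k b) (lit-clause _) = refl

  ancestor⇒edge : ∀ {x y} → Ancestor I x y → nodeOf x ≡ root ⊎ Edge (nodeOf x) (nodeOf y)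
  ancestor⇒edge (par p) = inj₂ (parent⇒edge p)
  ancestor⇒edge (step a p) with ancestor⇒edge a
  ... | inj₁ x≡root = inj₁ x≡root
  ... | inj₂ e      = inj₁ (edge-edge⇒root e (parent⇒edge p))

  satisfiable⇒assignment : Satisfiable φ →
    Σ (Tasks → Nodes) λ a → Feasible I a × totalWeight I a ≡ n + m
  satisfiable⇒assignment (σ , sat) = a , (a-injective , a-antichain) , a-weight
    where
    chosen : Fin m ⊎ Fin n → Node n m
    chosen (inj₁ i) = clause i (proj₁ (sat i))
    chosen (inj₂ k) = lit k (not (σ k))

    task-chosen : ∀ s → task (chosen s) ≡ suc (toℕ (join m n s))
    task-chosen (inj₁ i) = cong suc (sym (toℕ-↑ˡ i n))
    task-chosen (inj₂ k) = trans (+-suc m (toℕ k)) (cong suc (sym (toℕ-↑ʳ m k)))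

    chosen≢root : ∀ s → chosen s ≢ root
    chosen≢root (inj₁ i) ()
    chosen≢root (inj₂ k) ()

    chosen-no-edge : ∀ s s′ → ¬ Edge (chosen s) (chosen s′)
    chosen-no-edge (inj₂ k) (inj₁ i) (lit-clause e) = contradiction (begin
      false                          ≡⟨ litVal-not σ k ⟨
      litVal σ (k , not (σ k))       ≡⟨ cong (litVal σ) e ⟨
      litVal σ (φ i (proj₁ (sat i))) ≡⟨ proj₂ (sat i) ⟩
      true                           ∎) λ ()
      where open ≡-Reasoning
    chosen-no-edge (inj₁ i) (inj₁ i′) ()
    chosen-no-edge (inj₁ i) (inj₂ k′) ()
    chosen-no-edge (inj₂ k) (inj₂ k′) ()

    a : Tasks → Nodes
    a = toFin ∘ chosen ∘ splitAt m

    nodeOf-a : ∀ t → nodeOf (a t) ≡ chosen (splitAt m t)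
    nodeOf-a t = nodeOf-toFin (chosen (splitAt m t))

    task-a : ∀ t → task (nodeOf (a t)) ≡ suc (toℕ t)
    task-a t = trans (cong task (nodeOf-a t))
                     (trans (task-chosen (splitAt m t)) (cong (suc ∘ toℕ) (join-splitAt m n t)))

    a-injective : ∀ {t t′} → a t ≡ a t′ → t ≡ t′
    a-injective {t} {t′} at≡at′ = toℕ-injective (suc-injective (begin
      suc (toℕ t)         ≡⟨ task-a t ⟨
      task (nodeOf (a t))  ≡⟨ cong (task ∘ nodeOf) at≡at′ ⟩
      task (nodeOf (a t′)) ≡⟨ task-a t′ ⟩
      suc (toℕ t′)        ∎))
      where open ≡-Reasoning

    a-antichain : ∀ t t′ → ¬ Ancestor I (a t) (a t′)
    a-antichain t t′ anc with ancestor⇒edge anc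
    ... | inj₁ at≡root = chosen≢root (splitAt m t) (trans (sym (nodeOf-a t)) at≡root)
    ... | inj₂ e       =
      chosen-no-edge (splitAt m t) (splitAt m t′) (subst₂ Edge (nodeOf-a t) (nodeOf-a t′) e)

    a-weight : totalWeight I a ≡ n + m
    a-weight = trans (sum-tabulate-≡1 _ weight≡1) (+-comm m n)
      where
      weight≡1 : ∀ t → MWTM.weight I (a t) t ≡ 1
      weight≡1 t = subst (λ l → wL n m l (suc (toℕ t)) ≡ 1) (label-nodeOf (a t))
        (wL-label-task (nodeOf (a t)) (toℕ t) (sym (task-a t)))

  assignment⇒satisfiable : (a : Tasks → Nodes) → Feasible I a → totalWeight I a ≡ n + m →
                           Satisfiable φ
  assignment⇒satisfiable a (_ , antichain) total = σ , satisfied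
    where
    weight≡1 : ∀ t → MWTM.weight I (a t) t ≡ 1
    weight≡1 = sum-tabulate-≤1-≡ _ weight≤1 (trans total (+-comm n m))
      where
      weight≤1 : ∀ t → MWTM.weight I (a t) t ≤ 1
      weight≤1 t = subst (λ l → wL n m l (suc (toℕ t)) ≤ 1) (label-nodeOf (a t))
                         (wL-label≤1 (nodeOf (a t)) (toℕ t))

    task-a : ∀ t → suc (toℕ t) ≡ task (nodeOf (a t))
    task-a t = wL-label≡1⇒ (nodeOf (a t)) (toℕ t)
      (subst (λ l → wL n m l (suc (toℕ t)) ≡ 1) (sym (label-nodeOf (a t))) (weight≡1 t))

    variable-node : ∀ k → ∃ λ b → nodeOf (a (m ↑ʳ k)) ≡ lit k b
    variable-node k = task≡lit⇒ _ k
      (trans (sym (task-a (m ↑ʳ k))) (trans (cong suc (toℕ-↑ʳ m k)) (sym (+-suc m (toℕ k)))))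

    clause-node : ∀ i → ∃ λ j → nodeOf (a (i ↑ˡ n)) ≡ clause i j
    clause-node i = task≡clause⇒ _ i (trans (sym (task-a (i ↑ˡ n))) (cong suc (toℕ-↑ˡ i n)))

    σ : Fin n → Bool
    σ k = not (proj₁ (variable-node k))

    occurrence-true : ∀ i j → nodeOf (a (i ↑ˡ n)) ≡ clause i j → litVal σ (φ i j) ≡ true
    occurrence-true i j node≡ with φ i j in φij
    ... | k , b = ¬-not λ unsat → antichain (m ↑ʳ k) (i ↑ˡ n) (par (edge⇒parent
      (subst₂ Edge (sym (proj₂ (variable-node k))) (sym node≡)
        (lit-clause (trans φij (cong (k ,_) (trans (litVal≡false⇒ σ k b unsat) (not-involutive _))))))))

    satisfied : ∀ i → ∃ λ j → litVal σ (φ i j) ≡ true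
    satisfied i with j , node≡ ← clause-node i = j , occurrence-true i j node≡

lemma1 : (n m : ℕ) (φ : E3SAT n m) →
    Satisfiable φ ⇔
      Σ (Fin (MWTM.M (reduction φ)) → Fin (MWTM.N (reduction φ))) (λ a →
        Feasible (reduction φ) a × totalWeight (reduction φ) a ≡ n + m)
lemma1 n m φ = mk⇔ (satisfiable⇒assignment φ)
                   (λ (a , feasible , total) → assignment⇒satisfiable φ a feasible total)
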